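{- Let $\beta>1$ be the root of $x^2-ax-1$ with $a$ a positive integer, and $\alpha=-\beta^{ -1}$. Let $q\in\mathbb{Q}\cap(-1,1)$ and run the following algorithm. Start with $s^{(0)}_0=q$ and $s^{(0)}_j=0$ for $j\ge1$. For $i=0,1,2,\dots$, obtain $s^{(i+1)}$ from $s^{(i)}$ by setting $\delta=\lceil s^{(i)}_i\rceil-s^{(i)}_i$ and $s^{(i+1)}_i=\lceil s^{(i)}_i\rceil$, $s^{(i+1)}_{i+1}=s^{(i)}_{i+1}+a\delta$, $s^{(i+1)}_{i+2}=s^{(i)}_{i+2}-\delta$, and $s^{(i+1)}_j=s^{(i)}_j$ for all other $j$. Then for every $i\ge0$: $s^{(i+1)}_0,\dots,s^{(i+1)}_i$ belong to $\{0,1,\dots,a\}$, $s^{(i+1)}_{i+1}\in(-1,a)$, and $s^{(i+1)}_{i+2}\in(-1,0]$.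
   Context: The step replaces the digits $(s_{i+2},s_{i+1},s_i)$ by $(s_{i+2}-\delta,\ s_{i+1}+a\delta,\ \lceil s_i\rceil)$ with $\delta=\lceil s_i\rceil-s_i$, which preserves $\sum_j s_j\alpha^j$ since $\alpha^2=a\alpha+1$. -}

module Defs where

open import Data.Nat as ℕ using (ℕ; zero; suc)
open import Data.Integer as ℤ using (ℤ; +_)
open import Data.Rational using (ℚ; _+_; _-_; _*_; ceiling; 0ℚ; 1ℚ; -_)
open import Data.Bool using (if_then_else_)

ℤ→ℚ : ℤ → ℚ
ℤ→ℚ z = Data.Rational._/_ z 1

ℕ→ℚ : ℕ → ℚ
ℕ→ℚ n = ℤ→ℚ (+ n)

ceilℚ : ℚ → ℚ
ceilℚ x = ℤ→ℚ (ceiling x)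

initSeq : ℚ → ℕ → ℚ
initSeq q zero    = q
initSeq q (suc _) = 0ℚ

step : ℕ → ℕ → (ℕ → ℚ) → (ℕ → ℚ)
step a i s j =
  if j ℕ.≡ᵇ i then ceilℚ (s i)
  else if j ℕ.≡ᵇ suc i then s (suc i) + ℕ→ℚ a * δ
  else if j ℕ.≡ᵇ suc (suc i) then s (suc (suc i)) - δ
  else s j
  where δ = ceilℚ (s i) - s i

seqAt : ℕ → ℚ → ℕ → (ℕ → ℚ)
seqAt a q zero    = initSeq q
seqAt a q (suc i) = step a i (seqAt a q i)

{-# OPTIONS --safe #-}
module Submission where

-- After i steps the state satisfies an invariant: the entries below i are digits in
-- {0,…,a}, s_i ∈ (-1,a), s_{i+1} ∈ (-1,0], and every later entry is 0. Step i replaces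
-- s_i by its ceiling, a digit because s_i ∈ (-1,a); the gap δ = ⌈s_i⌉ - s_i lies in [0,1),
-- so s_{i+1} + aδ lands in (-1,a) and s_{i+2} - δ = -δ in (-1,0], which is the invariant
-- at stage i+1.

open import Defs
open import Data.Bool using (true; false)
open import Data.Integer as ℤ using (ℤ; +_; -[1+_])
open import Data.Integer.DivMod using ([n/d]*d≤n; n<s[n/ℕd]*d; div-pos-is-/ℕ)
import Data.Integer.Properties as ℤP
open import Data.Nat as ℕ using (ℕ; zero; suc; _+_; _<_; _≤_)
open import Data.Nat.Coprimality using (1-coprimeTo) renaming (sym to coprime-sym)
import Data.Nat.Properties as ℕP
open import Data.Product using (_×_; _,_; ∃-syntax)
open import Data.Rational as ℚ using (ℚ; mkℚ; -_; 0ℚ; 1ℚ; floor; ceiling)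
import Data.Rational.Properties as ℚP
open import Algebra.Properties.Ring ℚP.+-*-ring using (-‿involutive)
open import Data.Rational.Solver using (module +-*-Solver)
open import Data.Sum using (inj₁; inj₂)
open import Relation.Binary.PropositionalEquality
open import Relation.Nullary.Decidable using (dec-true; dec-false)

ℤ→ℚ-mkℚ : ∀ z → ℤ→ℚ z ≡ mkℚ z 0 (coprime-sym (1-coprimeTo ℤ.∣ z ∣))
ℤ→ℚ-mkℚ z = ℚP.↥p/↧p≡p (mkℚ z 0 _)

ℤ→ℚ-mono-≤ : ∀ {m n} → m ℤ.≤ n → ℤ→ℚ m ℚ.≤ ℤ→ℚ n
ℤ→ℚ-mono-≤ {m} {n} m≤n rewrite ℤ→ℚ-mkℚ m | ℤ→ℚ-mkℚ n =
  ℚ.*≤* (subst₂ ℤ._≤_ (sym (ℤP.*-identityʳ m)) (sym (ℤP.*-identityʳ n)) m≤n)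

ℤ→ℚ-cancel-< : ∀ {m n} → ℤ→ℚ m ℚ.< ℤ→ℚ n → m ℤ.< n
ℤ→ℚ-cancel-< {m} {n} m<n rewrite ℤ→ℚ-mkℚ m | ℤ→ℚ-mkℚ n with m<n
... | ℚ.*<* m*1<n*1 = subst₂ ℤ._<_ (ℤP.*-identityʳ m) (ℤP.*-identityʳ n) m*1<n*1

ℤ→ℚ-neg : ∀ n → ℤ→ℚ (ℤ.- n) ≡ - ℤ→ℚ n
ℤ→ℚ-neg n rewrite ℤ→ℚ-mkℚ n | ℤ→ℚ-mkℚ (ℤ.- n) with n
... | + zero   = refl
... | + suc _  = refl
... | -[1+ _ ] = refl

ℤ→ℚ-+ : ∀ m n → ℤ→ℚ (m ℤ.+ n) ≡ ℤ→ℚ m ℚ.+ ℤ→ℚ n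
ℤ→ℚ-+ m n rewrite ℤ→ℚ-mkℚ m | ℤ→ℚ-mkℚ n =
  cong (ℚ._/ 1) (sym (cong₂ ℤ._+_ (ℤP.*-identityʳ m) (ℤP.*-identityʳ n)))

ℤ→ℚ-≤ : ∀ {z p} → z ℤ.* ℚ.↧ p ℤ.≤ ℚ.↥ p → ℤ→ℚ z ℚ.≤ p
ℤ→ℚ-≤ {z} {p@record{}} z*q≤n = subst (ℚ._≤ p) (sym (ℤ→ℚ-mkℚ z))
  (ℚ.*≤* (subst (z ℤ.* ℚ.↧ p ℤ.≤_) (sym (ℤP.*-identityʳ (ℚ.↥ p))) z*q≤n))

<-ℤ→ℚ : ∀ {z p} → ℚ.↥ p ℤ.< z ℤ.* ℚ.↧ p → p ℚ.< ℤ→ℚ z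
<-ℤ→ℚ {z} {p@record{}} n<z*q = subst (p ℚ.<_) (sym (ℤ→ℚ-mkℚ z))
  (ℚ.*<* (subst (ℤ._< z ℤ.* ℚ.↧ p) (sym (ℤP.*-identityʳ (ℚ.↥ p))) n<z*q))

⌊p⌋≤p : ∀ p → ℤ→ℚ ⌊ p ⌋ ℚ.≤ p
⌊p⌋≤p p@(mkℚ n d _) = ℤ→ℚ-≤ {⌊ p ⌋} ([n/d]*d≤n n (+ suc d))

p<suc⌊p⌋ : ∀ p → p ℚ.< ℤ→ℚ (ℤ.suc ⌊ p ⌋)
p<suc⌊p⌋ p@(mkℚ n d _) =
  <-ℤ→ℚ {ℤ.suc ⌊ p ⌋} (subst (λ f → n ℤ.< ℤ.suc f ℤ.* + suc d)
                              (sym (div-pos-is-/ℕ n (suc d)))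
                              (n<s[n/ℕd]*d n (suc d)))

p≤⌈p⌉ : ∀ p → p ℚ.≤ ceilℚ p
p≤⌈p⌉ p@record{} = begin
  p                  ≡⟨ -‿involutive p ⟨
  - - p              ≤⟨ ℚP.neg-antimono-≤ (⌊p⌋≤p (- p)) ⟩
  - ℤ→ℚ ⌊ - p ⌋      ≡⟨ ℤ→ℚ-neg ⌊ - p ⌋ ⟨
  ceilℚ p            ∎
  where open ℚP.≤-Reasoning

pred⌈p⌉<p : ∀ p → ℤ→ℚ (ℤ.pred ⌈ p ⌉) ℚ.< p
pred⌈p⌉<p p@record{} = begin-strict
  ℤ→ℚ (ℤ.pred ⌈ p ⌉)          ≡⟨ cong ℤ→ℚ (ℤP.neg-distrib-+ (+ 1) ⌊ - p ⌋) ⟨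
  ℤ→ℚ (ℤ.- ℤ.suc ⌊ - p ⌋)     ≡⟨ ℤ→ℚ-neg (ℤ.suc ⌊ - p ⌋) ⟩
  - ℤ→ℚ (ℤ.suc ⌊ - p ⌋)       <⟨ ℚP.neg-antimono-< (p<suc⌊p⌋ (- p)) ⟩
  - - p                       ≡⟨ -‿involutive p ⟩
  p                           ∎
  where open ℚP.≤-Reasoning

0≤⌈p⌉-p : ∀ p → 0ℚ ℚ.≤ ceilℚ p ℚ.- p
0≤⌈p⌉-p p = begin
  0ℚ               ≡⟨ ℚP.+-inverseʳ p ⟨
  p ℚ.- p          ≤⟨ ℚP.+-monoˡ-≤ (- p) (p≤⌈p⌉ p) ⟩
  ceilℚ p ℚ.- p    ∎
  where open ℚP.≤-Reasoning

⌈p⌉-p<1 : ∀ p → ceilℚ p ℚ.- p ℚ.< 1ℚ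
⌈p⌉-p<1 p = begin-strict
  ceilℚ p ℚ.- p                             ≡⟨ regroup ⟩
  (- 1ℚ ℚ.+ ceilℚ p) ℚ.+ (1ℚ ℚ.- p)         ≡⟨ cong (ℚ._+ (1ℚ ℚ.- p)) (ℤ→ℚ-+ ℤ.-1ℤ ⌈ p ⌉) ⟨
  ℤ→ℚ (ℤ.pred ⌈ p ⌉) ℚ.+ (1ℚ ℚ.- p)        <⟨ ℚP.+-monoˡ-< (1ℚ ℚ.- p) (pred⌈p⌉<p p) ⟩
  p ℚ.+ (1ℚ ℚ.- p)                          ≡⟨ cancel ⟩
  1ℚ                                        ∎
  where
  open ℚP.≤-Reasoning
  open +-*-Solver
  regroup : ceilℚ p ℚ.- p ≡ (- 1ℚ ℚ.+ ceilℚ p) ℚ.+ (1ℚ ℚ.- p)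
  regroup = solve 2 (λ c p → c :- p := (:- con 1ℚ :+ c) :+ (con 1ℚ :- p))
                    refl (ceilℚ p) p
  cancel : p ℚ.+ (1ℚ ℚ.- p) ≡ 1ℚ
  cancel = solve 1 (λ p → p :+ (con 1ℚ :- p) := con 1ℚ) refl p

IsDigit : ℕ → ℚ → Set
IsDigit a x = ∃[ d ] (d ≤ a × x ≡ ℕ→ℚ d)

digit-ℤ : ∀ a {c} → ℤ.-1ℤ ℤ.< c → ℤ.pred c ℤ.< + a → ∃[ d ] (d ≤ a × c ≡ + d)
digit-ℤ a {+ zero}    _          _           = 0 , ℕ.z≤n , refl
digit-ℤ a {+ suc k}   _          (ℤ.+<+ k<a) = suc k , k<a , refl
digit-ℤ a { -[1+ _ ]} (ℤ.-<- ()) _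

⌈p⌉-isDigit : ∀ a {p} → - 1ℚ ℚ.< p → p ℚ.< ℕ→ℚ a → IsDigit a (ceilℚ p)
⌈p⌉-isDigit a {p} -1<p p<a
  with d , d≤a , ⌈p⌉≡d ← digit-ℤ a {⌈ p ⌉} (ℤ→ℚ-cancel-< (ℚP.<-≤-trans -1<p (p≤⌈p⌉ p)))
                                   (ℤ→ℚ-cancel-< (ℚP.<-trans (pred⌈p⌉<p p) p<a))
  = d , d≤a , cong ℤ→ℚ ⌈p⌉≡d

≡ᵇ-refl : ∀ n → (n ℕ.≡ᵇ n) ≡ true
≡ᵇ-refl n = dec-true (n ℕP.≟ n) refl

≢⇒≡ᵇ-false : ∀ {m n} → m ≢ n → (m ℕ.≡ᵇ n) ≡ false
≢⇒≡ᵇ-false {m} {n} = dec-false (m ℕP.≟ n)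

module _ (a i : ℕ) (s : ℕ → ℚ) where

  step-i : step a i s i ≡ ceilℚ (s i)
  step-i rewrite ≡ᵇ-refl i = refl

  step-1+i : step a i s (suc i) ≡ s (suc i) ℚ.+ ℕ→ℚ a ℚ.* (ceilℚ (s i) ℚ.- s i)
  step-1+i rewrite ≢⇒≡ᵇ-false (ℕP.1+n≢n {i}) | ≡ᵇ-refl i = refl

  step-2+i : step a i s (2 + i) ≡ s (2 + i) ℚ.- (ceilℚ (s i) ℚ.- s i)
  step-2+i rewrite ≢⇒≡ᵇ-false (ℕP.>⇒≢ (ℕP.m<n⇒m<1+n (ℕP.n<1+n i)))
                 | ≢⇒≡ᵇ-false (ℕP.1+n≢n {suc i}) | ≡ᵇ-refl i = refl

  step-other : ∀ {j} → j ≢ i → j ≢ 1 + i → j ≢ 2 + i → step a i s j ≡ s j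
  step-other j≢i j≢1+i j≢2+i
    rewrite ≢⇒≡ᵇ-false j≢i | ≢⇒≡ᵇ-false j≢1+i | ≢⇒≡ᵇ-false j≢2+i = refl

  step-below : ∀ {j} → j < i → step a i s j ≡ s j
  step-below j<i = step-other (ℕP.<⇒≢ j<i) (ℕP.<⇒≢ (ℕP.m<n⇒m<1+n j<i))
                              (ℕP.<⇒≢ (ℕP.m<n⇒m<1+n (ℕP.m<n⇒m<1+n j<i)))

  step-above : ∀ {j} → 3 + i ≤ j → step a i s j ≡ s j
  step-above 3+i≤j =
    step-other (ℕP.>⇒≢ (ℕP.<-trans (ℕP.n<1+n i) 2+i<j)) (ℕP.>⇒≢ 2+i<j) (ℕP.>⇒≢ 3+i≤j)
    where 2+i<j = ℕP.<-trans (ℕP.n<1+n (suc i)) 3+i≤j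

record Admissible (a i : ℕ) (s : ℕ → ℚ) : Set where
  field
    digit      : ∀ j → j < i → IsDigit a (s j)
    -1<s[i]    : - 1ℚ ℚ.< s i
    s[i]<a     : s i ℚ.< ℕ→ℚ a
    -1<s[1+i]  : - 1ℚ ℚ.< s (suc i)
    s[1+i]≤0   : s (suc i) ℚ.≤ 0ℚ
    s[j]≡0     : ∀ j → 2 + i ≤ j → s j ≡ 0ℚ

initSeq-admissible : ∀ {a q} → - 1ℚ ℚ.< q → q ℚ.< ℕ→ℚ a → Admissible a 0 (initSeq q)
initSeq-admissible -1<q q<a = record
  { digit      = λ _ ()
  ; -1<s[i]    = -1<q
  ; s[i]<a     = q<a
  ; -1<s[1+i]  = ℚP.neg-antimono-< (ℚP.positive⁻¹ _)
  ; s[1+i]≤0   = ℚP.≤-refl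
  ; s[j]≡0     = λ { (suc (suc _)) _ → refl ; (suc zero) (ℕ.s≤s ()) ; zero () }
  }

step-admissible : ∀ {a i s} .{{_ : ℚ.Positive (ℕ→ℚ a)}} →
                  Admissible a i s → Admissible a (suc i) (step a i s)
step-admissible {a} {i} {s} adm = record
  { digit      = digit′
  ; -1<s[i]    = begin-strict
      - 1ℚ                      ≡⟨ ℚP.+-identityʳ (- 1ℚ) ⟨
      - 1ℚ ℚ.+ 0ℚ               <⟨ ℚP.+-mono-<-≤ -1<s[1+i] 0≤aδ ⟩
      s (suc i) ℚ.+ aδ          ≡⟨ step-1+i a i s ⟨
      step a i s (suc i)        ∎
  ; s[i]<a     = begin-strict
      step a i s (suc i)        ≡⟨ step-1+i a i s ⟩
      s (suc i) ℚ.+ aδ          ≤⟨ ℚP.+-monoˡ-≤ aδ s[1+i]≤0 ⟩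
      0ℚ ℚ.+ aδ                 ≡⟨ ℚP.+-identityˡ aδ ⟩
      aδ                        <⟨ aδ<a ⟩
      ℕ→ℚ a                     ∎
  ; -1<s[1+i]  = subst (- 1ℚ ℚ.<_) (sym new-s[2+i]) (ℚP.neg-antimono-< (⌈p⌉-p<1 (s i)))
  ; s[1+i]≤0   = subst (ℚ._≤ 0ℚ) (sym new-s[2+i]) (ℚP.neg-antimono-≤ (0≤⌈p⌉-p (s i)))
  ; s[j]≡0     = λ j 3+i≤j → trans (step-above a i s 3+i≤j) (s[j]≡0 j (ℕP.<⇒≤ 3+i≤j))
  }
  where
  open Admissible adm
  open ℚP.≤-Reasoning
  δ = ceilℚ (s i) ℚ.- s i
  aδ = ℕ→ℚ a ℚ.* δ

  0≤aδ : 0ℚ ℚ.≤ aδ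
  0≤aδ = subst (ℚ._≤ aδ) (ℚP.*-zeroʳ (ℕ→ℚ a))
    (ℚP.*-monoˡ-≤-nonNeg (ℕ→ℚ a) {{ℚP.pos⇒nonNeg (ℕ→ℚ a)}} (0≤⌈p⌉-p (s i)))

  aδ<a : aδ ℚ.< ℕ→ℚ a
  aδ<a = subst (aδ ℚ.<_) (ℚP.*-identityʳ (ℕ→ℚ a))
    (ℚP.*-monoʳ-<-pos (ℕ→ℚ a) (⌈p⌉-p<1 (s i)))

  new-s[2+i] : step a i s (2 + i) ≡ - δ
  new-s[2+i] = begin-equality
    step a i s (2 + i)    ≡⟨ step-2+i a i s ⟩
    s (2 + i) ℚ.- δ       ≡⟨ cong (ℚ._- δ) (s[j]≡0 (2 + i) ℕP.≤-refl) ⟩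
    0ℚ ℚ.- δ              ≡⟨ ℚP.+-identityˡ (- δ) ⟩
    - δ                   ∎

  digit′ : ∀ j → j < suc i → IsDigit a (step a i s j)
  digit′ j j<1+i with ℕP.m<1+n⇒m<n∨m≡n j<1+i
  ... | inj₁ j<i  = subst (IsDigit a) (sym (step-below a i s j<i)) (digit j j<i)
  ... | inj₂ refl = subst (IsDigit a) (sym (step-i a i s)) (⌈p⌉-isDigit a -1<s[i] s[i]<a)

seqAt-admissible : ∀ {a q} .{{_ : ℚ.Positive (ℕ→ℚ a)}} → - 1ℚ ℚ.< q → q ℚ.< ℕ→ℚ a →
                   ∀ i → Admissible a i (seqAt a q i)
seqAt-admissible {a} -1<q q<a zero    = initSeq-admissible {a} -1<q q<a
seqAt-admissible     -1<q q<a (suc i) = step-admissible (seqAt-admissible -1<q q<a i)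

mainTheorem9 : (a : ℕ) → 1 ≤ a → (q : ℚ) → (- 1ℚ) ℚ.< q → q ℚ.< 1ℚ →
    (i : ℕ) →
      ((j : ℕ) → j ≤ i → ∃[ d ] (d ≤ a × seqAt a q (suc i) j ≡ ℕ→ℚ d))
      × ((- 1ℚ) ℚ.< seqAt a q (suc i) (suc i) × seqAt a q (suc i) (suc i) ℚ.< ℕ→ℚ a)
      × ((- 1ℚ) ℚ.< seqAt a q (suc i) (suc (suc i)) × seqAt a q (suc i) (suc (suc i)) ℚ.≤ 0ℚ)
mainTheorem9 a 1≤a q -1<q q<1 i =
  (λ j j≤i → digit j (ℕ.s≤s j≤i)) , (-1<s[i] , s[i]<a) , (-1<s[1+i] , s[1+i]≤0)
  where
  1≤ℕ→ℚa : 1ℚ ℚ.≤ ℕ→ℚ a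
  1≤ℕ→ℚa = ℤ→ℚ-mono-≤ (ℤ.+≤+ 1≤a)
  instance
    a-pos : ℚ.Positive (ℕ→ℚ a)
    a-pos = ℚ.positive {ℕ→ℚ a} (ℚP.<-≤-trans (ℚP.positive⁻¹ 1ℚ) 1≤ℕ→ℚa)
  open Admissible (seqAt-admissible {a} -1<q (ℚP.<-≤-trans q<1 1≤ℕ→ℚa) (suc i))
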